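{- Let $t\ge1$ and $n\ge2$ be integers. Then: \begin{itemize} \item if $m=3t$: $\gamma_{[2]R}(C_m\Box P_n)\le t(2n+2)$; \item if $m=4t$: $\gamma_{[2]R}(C_m\Box P_n)\le 3tn$; \item if $m=5t$: $\gamma_{[2]R}(C_m\Box P_n)\le t(3n+4)$; \item if $m=6t$ and $n\equiv0\pmod3$: $\gamma_{[2]R}(C_m\Box P_n)\le t\bigl(3\lceil 4n/3\rceil+3\bigr)$; \item if $m=6t$ and $n\equiv1\pmod3$: $\gamma_{[2]R}(C_m\Box P_n)\le 3t\lceil 4n/3\rceil$; \item if $m=6t$ and $n\equiv2\pmod3$: $\gamma_{[2]R}(C_m\Box P_n)\le t\bigl(3\lceil 4n/3\rceil+2\bigr)$; \item if $m=7t$ and $n$ is odd: $\gamma_{[2]R}(C_m\Box P_n)\le t\,\frac{9n+11}{2}$; \item if $m=7t$ and $n$ is even: $\gamma_{[2]R}(C_m\Box P_n)\le t\,\frac{9n+10}{2}$; \item if $m=8t$: $\gamma_{[2]R}(C_m\Box P_n)\le t\left(6n-\left(\lfloor\frac{n-2}{5}\rfloor+\lfloor\frac{n}{5}\rfloor\right)+4\right)$; \item if $m=9t$: $\gamma_{[2]R}(C_m\Box P_n)\le t(6n+4)$. \end{itemize}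
   Context: All graphs are finite and simple. For a vertex $v$ of a graph $G$, $N(v)$ denotes its open neighborhood and $N[v]=N(v)\cup\{v\}$ its closed neighborhood. For $f:V(G)\to\mathbb{N}_0$ and $S\subseteq V(G)$ write $f(S)=\sum_{u\in S}f(u)$. For a positive integer $k$, a $[k]$-Roman dominating function of $G$ is a function $f:V(G)\to\{0,1,\dots,k+1\}$ such that every vertex $v$ with $f(v)<k$ satisfies $f(N[v])\ge k+|AN(v)|$, where $AN(v)=\{u\in N(v): f(u)>0\}$. The $[k]$-Roman domination number $\gamma_{[k]R}(G)$ is the minimum of $f(V(G))$ over all $[k]$-Roman dominating functions $f$ of $G$; $\gamma_{[2]R}$ is the double Roman domination number. $C_m\Box P_n$ denotes the Cartesian product of the cycle $C_m$ ($m\ge3$) and the path $P_n$ on $n$ vertices: its vertices are pairs $(i,j)$ with $i\in\{0,\dots,m-1\}$, $j\in\{0,\dots,n-1\}$, and $(i,j)$ is adjacent to $(i',j')$ iff either $j=j'$ and $i-i'\equiv\pm1\pmod m$, or $i=i'$ and $|j-j'|=1$. -}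

module Defs where

open import Data.Nat using (ℕ; zero; suc; _+_; _*_; _∸_; _≤_; _<_; _≡ᵇ_)
open import Data.Bool using (Bool; true; false; _∧_; _∨_; if_then_else_)
open import Data.Fin using (Fin; toℕ; remQuot)
open import Data.List using (List; map; allFin)
open import Data.Nat.ListAction using (sum)
open import Data.Product using (Σ; _×_; _,_; proj₁; proj₂)
open import Relation.Binary.PropositionalEquality using (_≡_)
open import Relation.Nullary using (¬_)
open import Relation.Unary using (Decidable)
open import Data.Nat.Properties using (_<?_)

-- A finite graph on vertex set Fin N, given by a Boolean adjacency relation
-- (the only instance used, C_m □ P_n with m ≥ 3, is simple by construction).
record Graph : Set where
  field
    N    : ℕ
    Adj  : Fin N → Fin N → Bool
open Graph public

Vertex : Graph → Set
Vertex G = Fin (N G)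

vertices : (G : Graph) → List (Vertex G)
vertices G = allFin (N G)

weight : (G : Graph) → (Vertex G → ℕ) → ℕ
weight G f = sum (map f (vertices G))

nbSum : (G : Graph) → (Vertex G → ℕ) → Vertex G → ℕ
nbSum G f v = sum (map (λ u → if Adj G v u then f u else 0) (vertices G))

closedNbSum : (G : Graph) → (Vertex G → ℕ) → Vertex G → ℕ
closedNbSum G f v = f v + nbSum G f v

activeNbCount : (G : Graph) → (Vertex G → ℕ) → Vertex G → ℕ
activeNbCount G f v =
  sum (map (λ u → if Adj G v u then (if 0 Data.Nat.<ᵇ f u then 1 else 0) else 0) (vertices G))

IsKRDF : ℕ → (G : Graph) → (Vertex G → ℕ) → Set
IsKRDF k G f =
  (∀ v → f v ≤ suc k) ×
  (∀ v → f v < k → k + activeNbCount G f v ≤ closedNbSum G f v)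

IsKRomanDomNumber : ℕ → Graph → ℕ → Set
IsKRomanDomNumber k G γ =
  (Σ (Vertex G → ℕ) λ f → IsKRDF k G f × weight G f ≡ γ) ×
  (∀ f → IsKRDF k G f → γ ≤ weight G f)

IsDoubleRomanDomNumber : Graph → ℕ → Set
IsDoubleRomanDomNumber = IsKRomanDomNumber 2

cycAdj : (m : ℕ) → ℕ → ℕ → Bool
cycAdj m a b = succMod a b ∨ succMod b a
  where
  succMod : ℕ → ℕ → Bool
  succMod x y = (suc x ≡ᵇ y) ∨ ((suc x ≡ᵇ m) ∧ (y ≡ᵇ 0))

pathAdj : ℕ → ℕ → Bool
pathAdj a b = (suc a ≡ᵇ b) ∨ (suc b ≡ᵇ a)

cylAdjPair : (m n : ℕ) → Fin m × Fin n → Fin m × Fin n → Bool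
cylAdjPair m n (i , j) (i' , j') =
  ((toℕ j ≡ᵇ toℕ j') ∧ cycAdj m (toℕ i) (toℕ i')) ∨
  ((toℕ i ≡ᵇ toℕ i') ∧ pathAdj (toℕ j) (toℕ j'))

cylAdj : (m n : ℕ) → Fin (m * n) → Fin (m * n) → Bool
cylAdj m n u v = cylAdjPair m n (remQuot n u) (remQuot n v)

CylPath : (m n : ℕ) → Graph
CylPath m n = record { N = m * n ; Adj = cylAdj m n }

{-# OPTIONS --safe #-}
-- Each bound is attained by an explicit double Roman dominating function that is
-- k-periodic around the cycle (k = 3, …, 9).  Such a function is a sequence of columns,
-- one per vertex of P_n, giving values in {0, 2, 3} to the k rows of C_k; repeating the
-- rows t times yields a function on C_{kt} □ P_n of t times the weight, and since k
-- divides kt every vertex sees the same neighbourhood values as its row in the pattern.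
-- As f(N[v]) − |AN(v)| = f(v) + Σ_{u ∈ N(v)} (f(u) ∸ 1), f is a [2]RDF when f ≤ 3 and
-- this sum is at least 2 everywhere.  The sum involves only three consecutive columns,
-- so validity is decided by a finite automaton reading the columns.  For each k the
-- columns are eventually periodic and the automaton is back in the same state after each
-- period, so finitely many computations certify a pattern for every n, and the weight
-- bound follows by induction on the number of periods.
module Submission where

open import Defs
open import Data.Nat using (ℕ; _+_; _*_; _∸_; _≤_; _/_; _%_)
open import Data.Product using (_×_)
open import Relation.Binary.PropositionalEquality using (_≡_)

open import Data.Bool using (Bool; true; false; T; if_then_else_; _∨_; _∧_)
open import Data.Bool.ListAction using (all)
open import Data.Bool.Properties using (T-≡; T-∨; T-∧; ∨-comm; ∧-assoc)
open import Data.Char using (Char; isSpace) renaming (toℕ to charCode)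
open import Data.Fin as Fin using (Fin; toℕ; combine; remQuot; _↑ˡ_; _↑ʳ_)
import Data.Fin.Properties as Finₚ
open import Data.List
  using (List; []; _∷_; _++_; length; map; allFin; tabulate; upTo; concat; replicate; take; wordsBy)
open import Data.List.Membership.Propositional.Properties using (∈-upTo⁺)
open import Data.List.NonEmpty using (List⁺; _∷_; toList)
open import Data.List.Properties using (map-tabulate; map-++; map-∘; map-cong; length-++; ++-assoc)
open import Data.List.Relation.Unary.All as All using (All; []; _∷_)
import Data.List.Relation.Unary.All.Properties as Allₚ
open import Data.List.Relation.Unary.AllPairs using ([]; _∷_)
open import Data.List.Relation.Unary.Unique.Propositional using (Unique)
import Data.List.Relation.Unary.Unique.Propositional.Properties as Uniqueₚ
open import Data.Nat
  using ( zero; suc; pred; _<_; _≤ᵇ_; _<ᵇ_; _≡ᵇ_; _≟_; _<?_; z≤n; s≤s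
        ; NonZero; >-nonZero; >-nonZero⁻¹)
open import Data.Nat.DivMod
  using ( +-distrib-/-∣ʳ; m*n/n≡m; m/n≤m; m%n<n; n%n≡0; m<n⇒m%n≡m
        ; [m+n]%n≡m%n; [m+kn]%n≡m%n; m≡m%n+[m/n]*n)
open import Data.Nat.Divisibility using (_∣_; n∣m⇒m%n≡0; m∣m*n; divides-refl)
open import Data.Nat.ListAction using (sum)
open import Data.Nat.ListAction.Properties using (sum-++)
open import Data.Nat.Properties
open import Data.Nat.Tactic.RingSolver using (solve-∀)
open import Data.Product using (Σ-syntax; _,_; proj₁; proj₂; uncurry)
open import Data.String using (String) renaming (toList to chars)
open import Data.Sum using ([_,_]; inj₂)
open import Function using (id; _∘_)
open import Function.Bundles using (Equivalence)
open import Relation.Binary.PropositionalEquality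
  using (_≢_; refl; sym; trans; cong; cong₂; subst; module ≡-Reasoning)
open import Relation.Nullary using (¬_; does; yes; no; contradiction)
open import Relation.Nullary.Decidable using (T?)
open import Algebra.Properties.Semiring.Sum +-*-semiring
  using (sum-syntax; sum-cong-≗; ∑-distrib-+; ∑-comm; *-distribˡ-sum) renaming (sum to ∑)

sum-map-allFin : ∀ N (h : Fin N → ℕ) → sum (map h (allFin N)) ≡ ∑ h
sum-map-allFin N h = trans (cong sum (map-tabulate id h)) (sum-tabulate N h)
  where
  sum-tabulate : ∀ N (h : Fin N → ℕ) → sum (tabulate h) ≡ ∑ h
  sum-tabulate zero    h = refl
  sum-tabulate (suc N) h = cong (h Fin.zero +_) (sum-tabulate N (h ∘ Fin.suc))

∑-↑ : ∀ a b (h : Fin (a + b) → ℕ) →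
      ∑ h ≡ ∑[ i < a ] h (i ↑ˡ b) + ∑[ j < b ] h (a ↑ʳ j)
∑-↑ zero    b h = refl
∑-↑ (suc a) b h = trans (cong (h Fin.zero +_) (∑-↑ a b (h ∘ Fin.suc)))
                        (sym (+-assoc (h Fin.zero) _ _))

∑-combine : ∀ m n (h : Fin (m * n) → ℕ) → ∑ h ≡ ∑[ i < m ] ∑[ j < n ] h (combine i j)
∑-combine zero    n h = refl
∑-combine (suc m) n h =
  trans (∑-↑ n (m * n) h) (cong (∑[ j < n ] h (j ↑ˡ m * n) +_) (∑-combine m n (h ∘ (n ↑ʳ_))))

∑-periodic : ∀ k t (g : ℕ → ℕ) → (∀ x → g (k + x) ≡ g x) →
             ∑[ x < t * k ] g (toℕ x) ≡ t * ∑[ r < k ] g (toℕ r)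
∑-periodic k zero    g period = refl
∑-periodic k (suc t) g period = begin
  ∑[ x < k + t * k ] g (toℕ x)
    ≡⟨ ∑-↑ k (t * k) (g ∘ toℕ) ⟩
  ∑[ r < k ] g (toℕ (r ↑ˡ t * k)) + ∑[ x < t * k ] g (toℕ (k ↑ʳ x))
    ≡⟨ cong₂ _+_ (sum-cong-≗ {k} (λ r → cong g (Finₚ.toℕ-↑ˡ r (t * k))))
                 (sum-cong-≗ {t * k} (λ x → trans (cong g (Finₚ.toℕ-↑ʳ k x)) (period (toℕ x)))) ⟩
  ∑[ r < k ] g (toℕ r) + ∑[ x < t * k ] g (toℕ x)
    ≡⟨ cong (∑[ r < k ] g (toℕ r) +_) (∑-periodic k t g period) ⟩
  ∑[ r < k ] g (toℕ r) + t * ∑[ r < k ] g (toℕ r) ∎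
  where open ≡-Reasoning

zeroAt : ∀ {N} → Fin N → (Fin N → ℕ) → Fin N → ℕ
zeroAt s h u = if does (u Finₚ.≟ s) then 0 else h u

zeroAt-≢ : ∀ {N} {s u : Fin N} (h : Fin N → ℕ) → u ≢ s → zeroAt s h u ≡ h u
zeroAt-≢ {s = s} {u} h u≢s with u Finₚ.≟ s
... | yes u≡s = contradiction u≡s u≢s
... | no _    = refl

∑-zeroAt : ∀ {N} (h : Fin N → ℕ) s → ∑ h ≡ h s + ∑ (zeroAt s h)
∑-zeroAt h Fin.zero    = refl
∑-zeroAt h (Fin.suc s) = begin
  h₀ + ∑ (h ∘ Fin.suc)                   ≡⟨ cong (h₀ +_) (∑-zeroAt (h ∘ Fin.suc) s) ⟩
  h₀ + (h (Fin.suc s) + rest)            ≡⟨ +-comm h₀ _ ⟩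
  h (Fin.suc s) + rest + h₀              ≡⟨ +-assoc (h (Fin.suc s)) rest h₀ ⟩
  h (Fin.suc s) + (rest + h₀)            ≡⟨ cong (h (Fin.suc s) +_) (+-comm rest h₀) ⟩
  h (Fin.suc s) + (h₀ + rest)            ∎
  where
  open ≡-Reasoning
  h₀ = h Fin.zero
  rest = ∑ (zeroAt s (h ∘ Fin.suc))

sum-≤-∑ : ∀ {N} {g h : Fin N → ℕ} {us} → Unique us → All (λ u → g u ≤ h u) us →
          sum (map g us) ≤ ∑ h
sum-≤-∑ [] [] = z≤n
sum-≤-∑ {g = g} {h} {u ∷ us} (u∉us ∷ unique) (gu≤hu ∷ g≤h) = begin
  g u + sum (map g us)   ≤⟨ +-mono-≤ gu≤hu (sum-≤-∑ unique (All.zipWith ≤-zeroAt (u∉us , g≤h))) ⟩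
  h u + ∑ (zeroAt u h)   ≡⟨ ∑-zeroAt h u ⟨
  ∑ h                    ∎
  where
  open ≤-Reasoning
  ≤-zeroAt : ∀ {v} → u ≢ v × g v ≤ h v → g v ≤ zeroAt u h v
  ≤-zeroAt (u≢v , gv≤hv) = ≤-trans gv≤hv (≤-reflexive (sym (zeroAt-≢ h (u≢v ∘ sym))))

-- The [k]RDF condition through excesses

excess : (G : Graph) → (Vertex G → ℕ) → Vertex G → ℕ
excess G f v = ∑[ u < N G ] (if Adj G v u then f u ∸ 1 else 0)

nbSum≡activeNbCount+excess : ∀ G f v → nbSum G f v ≡ activeNbCount G f v + excess G f v
nbSum≡activeNbCount+excess G f v = begin
  nbSum G f v                                     ≡⟨ sum-map-allFin (N G) _ ⟩
  ∑[ u < N G ] (if Adj G v u then f u else 0)     ≡⟨ sum-cong-≗ {N G} (λ u → split (Adj G v u) (f u)) ⟩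
  ∑[ u < N G ] (active u + (if Adj G v u then f u ∸ 1 else 0))
                                                  ≡⟨ ∑-distrib-+ active _ ⟩
  ∑ active + excess G f v                         ≡⟨ cong (_+ excess G f v) (sum-map-allFin (N G) active) ⟨
  activeNbCount G f v + excess G f v              ∎
  where
  open ≡-Reasoning
  active : Vertex G → ℕ
  active u = if Adj G v u then (if 0 <ᵇ f u then 1 else 0) else 0
  split : ∀ b x → (if b then x else 0) ≡
                  (if b then (if 0 <ᵇ x then 1 else 0) else 0) + (if b then x ∸ 1 else 0)
  split false x       = refl
  split true  zero    = refl
  split true  (suc x) = refl

excess⇒roman-condition : ∀ k G f v → k ≤ f v + excess G f v →
                  k + activeNbCount G f v ≤ closedNbSum G f v
excess⇒roman-condition k G f v k≤ = begin
  k + activeNbCount G f v                         ≤⟨ +-monoˡ-≤ _ k≤ ⟩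
  f v + excess G f v + activeNbCount G f v        ≡⟨ +-assoc (f v) _ _ ⟩
  f v + (excess G f v + activeNbCount G f v)      ≡⟨ cong (f v +_) (+-comm _ (activeNbCount G f v)) ⟩
  f v + (activeNbCount G f v + excess G f v)      ≡⟨ cong (f v +_) (nbSum≡activeNbCount+excess G f v) ⟨
  closedNbSum G f v                               ∎
  where open ≤-Reasoning

excess-≥ : ∀ G f v {us} → Unique us → All (T ∘ Adj G v) us →
           sum (map (λ u → f u ∸ 1) us) ≤ excess G f v
excess-≥ G f v unique adjacent = sum-≤-∑ unique (All.map (≤-reflexive ∘ sym ∘ if-T) adjacent)
  where
  if-T : ∀ {b : Bool} {x} → T b → (if b then x else 0) ≡ x
  if-T {true} _ = refl

cycSuc : ℕ → ℕ → ℕ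
cycSuc m x with suc x ≟ m
... | yes _ = 0
... | no  _ = suc x

cycPred : ℕ → ℕ → ℕ
cycPred m zero    = pred m
cycPred m (suc x) = x

cycSuc< : ∀ {m x} → x < m → cycSuc m x < m
cycSuc< {m} {x} x<m with suc x ≟ m
... | yes _      = ≤-trans (s≤s z≤n) x<m
... | no  1+x≢m = ≤∧≢⇒< x<m 1+x≢m

cycPred< : ∀ {m x} → x < m → cycPred m x < m
cycPred< {suc m} {zero}  _   = n<1+n m
cycPred< {m}     {suc x} x<m = <-trans (n<1+n x) x<m

cycSuc-cycPred : ∀ {m x} → x < m → cycSuc m (cycPred m x) ≡ x
cycSuc-cycPred {suc m} {zero} _ with suc m ≟ suc m
... | yes _  = refl
... | no 1+m≢1+m = contradiction refl 1+m≢1+m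
cycSuc-cycPred {m} {suc x} x<m with suc x ≟ m
... | yes 1+x≡m = contradiction 1+x≡m (<⇒≢ x<m)
... | no  _     = refl

cycPred-cycSuc : ∀ m x → cycPred m (cycSuc m x) ≡ x
cycPred-cycSuc m x with suc x ≟ m
... | yes 1+x≡m = cong pred (sym 1+x≡m)
... | no  _     = refl

cycSuc≢cycPred : ∀ {m x} → 3 ≤ m → cycSuc m x ≢ cycPred m x
cycSuc≢cycPred {suc (suc (suc m))} {zero}  (s≤s (s≤s (s≤s _))) ()
cycSuc≢cycPred {suc (suc (suc m))} {suc x} (s≤s (s≤s (s≤s _))) with suc (suc x) ≟ suc (suc (suc m))
... | yes 2+x≡3+m = λ { refl → contradiction 2+x≡3+m λ () }
... | no  _       = m≢1+n+m x ∘ sym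

suc-%≡cycSuc : ∀ x k .{{_ : NonZero k}} → suc x % k ≡ cycSuc k (x % k)
suc-%≡cycSuc x k = begin
  suc x % k                         ≡⟨ cong (λ y → suc y % k) (m≡m%n+[m/n]*n x k) ⟩
  (suc (x % k) + x / k * k) % k     ≡⟨ [m+kn]%n≡m%n (suc (x % k)) (x / k) k ⟩
  suc (x % k) % k                   ≡⟨ reduce (x % k) (m%n<n x k) ⟩
  cycSuc k (x % k)                  ∎
  where
  open ≡-Reasoning
  reduce : ∀ r → r < k → suc r % k ≡ cycSuc k r
  reduce r r<k with suc r ≟ k
  ... | yes 1+r≡k = trans (cong (_% k) 1+r≡k) (n%n≡0 k)
  ... | no  1+r≢k = m<n⇒m%n≡m (≤∧≢⇒< r<k 1+r≢k)

cycSuc-% : ∀ {k m x} .{{_ : NonZero k}} → k ∣ m → cycSuc m x % k ≡ cycSuc k (x % k)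
cycSuc-% {k} {m} {x} k∣m with suc x ≟ m
... | no  _     = suc-%≡cycSuc x k
... | yes 1+x≡m = begin
  0 % k             ≡⟨ m<n⇒m%n≡m (>-nonZero⁻¹ k) ⟩
  0                 ≡⟨ n∣m⇒m%n≡0 m k k∣m ⟨
  m % k             ≡⟨ cong (_% k) 1+x≡m ⟨
  suc x % k         ≡⟨ suc-%≡cycSuc x k ⟩
  cycSuc k (x % k)  ∎
  where open ≡-Reasoning

cycPred-% : ∀ {k m x} .{{_ : NonZero k}} → k ∣ m → x < m → cycPred m x % k ≡ cycPred k (x % k)
cycPred-% {k} {m} {x} k∣m x<m = begin
  cycPred m x % k                         ≡⟨ cycPred-cycSuc k (cycPred m x % k) ⟨
  cycPred k (cycSuc k (cycPred m x % k))  ≡⟨ cong (cycPred k) (cycSuc-% k∣m) ⟨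
  cycPred k (cycSuc m (cycPred m x) % k)  ≡⟨ cong (λ y → cycPred k (y % k)) (cycSuc-cycPred x<m) ⟩
  cycPred k (x % k)                       ∎
  where open ≡-Reasoning

≡ᵇ-refl : ∀ x → (x ≡ᵇ x) ≡ true
≡ᵇ-refl x = Equivalence.to T-≡ (≡⇒≡ᵇ x x refl)

cycAdj-cycSuc : ∀ m x → T (cycAdj m x (cycSuc m x))
cycAdj-cycSuc m x with suc x ≟ m
... | yes refl rewrite ≡ᵇ-refl x = _
... | no  _    rewrite ≡ᵇ-refl x = _

cycAdj-sym : ∀ m x y → cycAdj m x y ≡ cycAdj m y x
cycAdj-sym m x y = ∨-comm (step x y) (step y x)
  where
  -- cycAdj m x y unfolds to step x y ∨ step y x, but Defs keeps its copy of step local.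
  step : ℕ → ℕ → Bool
  step x y = (suc x ≡ᵇ y) ∨ ((suc x ≡ᵇ m) ∧ (y ≡ᵇ 0))

cycAdj-cycPred : ∀ {m x} → x < m → T (cycAdj m x (cycPred m x))
cycAdj-cycPred {m} {x} x<m = subst T (cycAdj-sym m _ x)
  (subst (T ∘ cycAdj m (cycPred m x)) (cycSuc-cycPred x<m) (cycAdj-cycSuc m (cycPred m x)))

pathAdj-suc : ∀ y → T (pathAdj y (suc y))
pathAdj-suc y rewrite ≡ᵇ-refl y = _

pathAdj-pred : ∀ y → T (pathAdj (suc y) y)
pathAdj-pred y = subst T (pathAdj-sym y (suc y)) (pathAdj-suc y)
  where
  pathAdj-sym : ∀ x y → pathAdj x y ≡ pathAdj y x
  pathAdj-sym x y = ∨-comm (suc x ≡ᵇ y) (suc y ≡ᵇ x)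

pathAdj-irrefl : ∀ y → ¬ T (pathAdj y y)
pathAdj-irrefl y adj = [ 1+y≢y , 1+y≢y ] (Equivalence.to T-∨ adj)
  where
  1+y≢y : ¬ T (suc y ≡ᵇ y)
  1+y≢y = 1+n≢n ∘ ≡ᵇ⇒≡ (suc y) y

-- Neighbourhoods in C_m □ P_n

cylAdj-combine : ∀ {m n} (i i' : Fin m) (j j' : Fin n) →
                 cylAdj m n (combine i j) (combine i' j') ≡ cylAdjPair m n (i , j) (i' , j')
cylAdj-combine {m} {n} i i' j j' =
  cong₂ (cylAdjPair m n) (Finₚ.remQuot-combine i j) (Finₚ.remQuot-combine i' j')

cylAdj-row : ∀ {m n} {i i' : Fin m} {j : Fin n} → T (cycAdj m (toℕ i) (toℕ i')) →
             T (cylAdj m n (combine i j) (combine i' j))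
cylAdj-row {m} {n} {i} {i'} {j} adj
  rewrite cylAdj-combine i i' j j | ≡ᵇ-refl (toℕ j) | Equivalence.to T-≡ adj = _

cylAdj-column : ∀ {m n} {i : Fin m} {j j' : Fin n} → T (pathAdj (toℕ j) (toℕ j')) →
                T (cylAdj m n (combine i j) (combine i j'))
cylAdj-column {m} {n} {i} {j} {j'} adj rewrite cylAdj-combine i i j j' =
  Equivalence.from T-∨ (inj₂ (Equivalence.from T-∧ (≡⇒≡ᵇ (toℕ i) (toℕ i) refl , adj)))

below : ∀ {n} → Fin n → List (Fin n)
below Fin.zero    = []
below (Fin.suc j) = Fin.inject₁ j ∷ []

above : ∀ {n} → Fin n → List (Fin n)
above {n} j with suc (toℕ j) <? n
... | yes j+1<n = Fin.fromℕ< j+1<n ∷ []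
... | no  _     = []

pathNbrs : ∀ {n} → Fin n → List (Fin n)
pathNbrs j = below j ++ above j

PathAdjacent : ∀ {n} → Fin n → Fin n → Set
PathAdjacent j j' = T (pathAdj (toℕ j) (toℕ j'))

pathNbrs-adjacent : ∀ {n} (j : Fin n) → All (PathAdjacent j) (pathNbrs j)
pathNbrs-adjacent j = Allₚ.++⁺ (below-adjacent j) (above-adjacent j)
  where
  below-adjacent : ∀ {n} (j : Fin n) → All (PathAdjacent j) (below j)
  below-adjacent Fin.zero    = []
  below-adjacent (Fin.suc j) =
    subst (T ∘ pathAdj (suc (toℕ j))) (sym (Finₚ.toℕ-inject₁ j)) (pathAdj-pred (toℕ j)) ∷ []
  above-adjacent : ∀ {n} (j : Fin n) → All (PathAdjacent j) (above j)
  above-adjacent {n} j with suc (toℕ j) <? n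
  ... | yes j+1<n = subst (T ∘ pathAdj (toℕ j)) (sym (Finₚ.toℕ-fromℕ< j+1<n)) (pathAdj-suc (toℕ j)) ∷ []
  ... | no  _     = []

pathNbrs-unique : ∀ {n} (j : Fin n) → Unique (pathNbrs j)
pathNbrs-unique Fin.zero    = above-unique Fin.zero
  where
  above-unique : ∀ {n} (j : Fin n) → Unique (above j)
  above-unique {n} j with suc (toℕ j) <? n
  ... | yes _ = [] ∷ []
  ... | no  _ = []
pathNbrs-unique {suc n} (Fin.suc j) with suc (suc (toℕ j)) <? suc n
... | yes j+2<n = (j-1≢j+1 ∷ []) ∷ [] ∷ []
  where
  j-1≢j+1 : Fin.inject₁ j ≢ Fin.fromℕ< j+2<n
  j-1≢j+1 eq = m≢1+n+m (toℕ j)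
    (trans (sym (Finₚ.toℕ-inject₁ j)) (trans (cong toℕ eq) (Finₚ.toℕ-fromℕ< j+2<n)))
... | no  _ = [] ∷ []

rowSuc : ∀ {m} → Fin m → Fin m
rowSuc i = Fin.fromℕ< (cycSuc< (Finₚ.toℕ<n i))

rowPred : ∀ {m} → Fin m → Fin m
rowPred i = Fin.fromℕ< (cycPred< (Finₚ.toℕ<n i))

toℕ-rowSuc : ∀ {m} (i : Fin m) → toℕ (rowSuc i) ≡ cycSuc m (toℕ i)
toℕ-rowSuc i = Finₚ.toℕ-fromℕ< (cycSuc< (Finₚ.toℕ<n i))

toℕ-rowPred : ∀ {m} (i : Fin m) → toℕ (rowPred i) ≡ cycPred m (toℕ i)
toℕ-rowPred i = Finₚ.toℕ-fromℕ< (cycPred< (Finₚ.toℕ<n i))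

cylNbrs : ∀ {m n} → Fin m → Fin n → List (Fin (m * n))
cylNbrs i j = combine (rowSuc i) j ∷ combine (rowPred i) j ∷ map (combine i) (pathNbrs j)

cylNbrs-adjacent : ∀ {m n} (i : Fin m) (j : Fin n) → All (T ∘ cylAdj m n (combine i j)) (cylNbrs i j)
cylNbrs-adjacent {m} {n} i j =
  cylAdj-row {m} {n} (subst (T ∘ cycAdj m (toℕ i)) (sym (toℕ-rowSuc i)) (cycAdj-cycSuc m (toℕ i))) ∷
  cylAdj-row {m} {n} (subst (T ∘ cycAdj m (toℕ i)) (sym (toℕ-rowPred i)) (cycAdj-cycPred (Finₚ.toℕ<n i))) ∷
  Allₚ.map⁺ (All.map (cylAdj-column {m} {n} {i} {j}) (pathNbrs-adjacent j))

cylNbrs-unique : ∀ {m n} → 3 ≤ m → (i : Fin m) (j : Fin n) → Unique (cylNbrs i j)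
cylNbrs-unique 3≤m i j =
  (suc≢pred ∷ Allₚ.map⁺ (All.map row≢column (pathNbrs-adjacent j))) ∷
  Allₚ.map⁺ (All.map row≢column (pathNbrs-adjacent j)) ∷
  Uniqueₚ.map⁺ (Finₚ.combine-injectiveʳ i _ i _) (pathNbrs-unique j)
  where
  suc≢pred : combine (rowSuc i) j ≢ combine (rowPred i) j
  suc≢pred eq = cycSuc≢cycPred 3≤m (begin
    cycSuc _ (toℕ i)     ≡⟨ toℕ-rowSuc i ⟨
    toℕ (rowSuc i)       ≡⟨ cong toℕ (Finₚ.combine-injectiveˡ _ j _ j eq) ⟩
    toℕ (rowPred i)      ≡⟨ toℕ-rowPred i ⟩
    cycPred _ (toℕ i)    ∎)
    where open ≡-Reasoning
  row≢column : ∀ {i' j'} → PathAdjacent j j' → combine i' j ≢ combine i j'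
  row≢column {i'} {j'} adj eq =
    pathAdj-irrefl (toℕ j) (subst (PathAdjacent j) (sym (Finₚ.combine-injectiveʳ i' j i j' eq)) adj)

cylinder-excess : ∀ {m n} → 3 ≤ m → ∀ f (i : Fin m) (j : Fin n) →
                  sum (map (λ u → f u ∸ 1) (cylNbrs i j)) ≤ excess (CylPath m n) f (combine i j)
cylinder-excess {m} {n} 3≤m f i j =
  excess-≥ (CylPath m n) f (combine i j) (cylNbrs-unique 3≤m i j) (cylNbrs-adjacent i j)

pathNbrs-sum : ∀ {n} (g : ℕ → ℕ) → g 0 ≡ 0 → (∀ y → n ≤ y → g (suc y) ≡ 0) → (j : Fin n) →
               g (toℕ j) + g (2 + toℕ j) ≡ sum (map (g ∘ suc ∘ toℕ) (pathNbrs j))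
pathNbrs-sum {n} g g0≡0 vanish j = begin
  g (toℕ j) + g (2 + toℕ j)                 ≡⟨ cong₂ _+_ (below-sum j) (above-sum j) ⟩
  sum (map h (below j)) + sum (map h (above j))
                                            ≡⟨ sum-++ (map h (below j)) _ ⟨
  sum (map h (below j) ++ map h (above j))  ≡⟨ cong sum (map-++ h (below j) (above j)) ⟨
  sum (map h (pathNbrs j))                  ∎
  where
  open ≡-Reasoning
  h : ∀ {n} → Fin n → ℕ
  h j = g (suc (toℕ j))
  below-sum : ∀ {n} (j : Fin n) → g (toℕ j) ≡ sum (map h (below j))
  below-sum Fin.zero    = g0≡0
  below-sum (Fin.suc j) = trans (cong (g ∘ suc) (sym (Finₚ.toℕ-inject₁ j))) (sym (+-identityʳ _))
  above-sum : (j : Fin n) → g (2 + toℕ j) ≡ sum (map h (above j))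
  above-sum j with suc (toℕ j) <? n
  ... | yes j+1<n = trans (cong (g ∘ suc) (sym (Finₚ.toℕ-fromℕ< j+1<n))) (sym (+-identityʳ _))
  ... | no  j+1≮n = vanish (suc (toℕ j)) (≮⇒≥ j+1≮n)

onGrid : ∀ {m n} → (ℕ → ℕ → ℕ) → Fin (m * n) → ℕ
onGrid {m} {n} F v = uncurry (λ i j → F (toℕ i) (toℕ j)) (remQuot {m} n v)

onGrid-combine : ∀ {m n} F (i : Fin m) (j : Fin n) → onGrid {m} {n} F (combine i j) ≡ F (toℕ i) (toℕ j)
onGrid-combine F i j = cong (uncurry (λ i j → F (toℕ i) (toℕ j))) (Finₚ.remQuot-combine i j)

weight-onGrid : ∀ {m n} F →
                weight (CylPath m n) (onGrid {m} {n} F) ≡ ∑[ j < n ] ∑[ i < m ] F (toℕ i) (toℕ j)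
weight-onGrid {m} {n} F = begin
  weight (CylPath m n) F'                  ≡⟨ sum-map-allFin (m * n) F' ⟩
  ∑ F'                                     ≡⟨ ∑-combine m n F' ⟩
  ∑[ i < m ] ∑[ j < n ] F' (combine i j)   ≡⟨ sum-cong-≗ {m} (sum-cong-≗ {n} ∘ onGrid-combine F) ⟩
  ∑[ i < m ] ∑[ j < n ] F (toℕ i) (toℕ j)  ≡⟨ ∑-comm {m} {n} (λ i j → F (toℕ i) (toℕ j)) ⟩
  ∑[ j < n ] ∑[ i < m ] F (toℕ i) (toℕ j)  ∎
  where
  open ≡-Reasoning
  F' = onGrid {m} {n} F

∀-combine : ∀ {m n} {P : Fin (m * n) → Set} → (∀ i j → P (combine i j)) → ∀ v → P v
∀-combine {m} {n} {P} P-combine v =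
  subst P (Finₚ.combine-remQuot {m} n v) (uncurry P-combine (remQuot {m} n v))

Column : Set
Column = List ℕ

at : ∀ {A : Set} → A → List A → ℕ → A
at d []       _       = d
at d (x ∷ xs) zero    = x
at d (x ∷ xs) (suc i) = at d xs i

at-≥ : ∀ {A : Set} (d : A) xs {i} → length xs ≤ i → at d xs i ≡ d
at-≥ d []       _         = refl
at-≥ d (x ∷ xs) (s≤s len≤i) = at-≥ d xs len≤i

∑-at : ∀ {A : Set} (d : A) (g : A → ℕ) xs → ∑[ i < length xs ] g (at d xs (toℕ i)) ≡ sum (map g xs)
∑-at d g []       = refl
∑-at d g (x ∷ xs) = cong (g x +_) (∑-at d g xs)

entry : Column → ℕ → ℕ
entry = at 0

column : List Column → ℕ → Column
column = at []

windowSum : ℕ → Column → Column → Column → ℕ → ℕ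
windowSum k p c d r =
  entry c r + ((entry c (cycSuc k r) ∸ 1) + ((entry c (cycPred k r) ∸ 1) + ((entry p r ∸ 1) + (entry d r ∸ 1))))

windowOK : ℕ → Column → Column → Column → Bool
windowOK k p c d = all (λ r → (entry c r ≤ᵇ 3) ∧ (2 ≤ᵇ windowSum k p c d r)) (upTo k)

windowOK-row : ∀ {k r} p c d → T (windowOK k p c d) → r < k → entry c r ≤ 3 × 2 ≤ windowSum k p c d r
windowOK-row {k} {r} p c d ok r<k =
  let ≤3 , 2≤ = Equivalence.to T-∧ (All.lookup (Allₚ.all⁺ rowOK (upTo k) ok) (∈-upTo⁺ r<k))
  in ≤ᵇ⇒≤ _ 3 ≤3 , ≤ᵇ⇒≤ 2 _ 2≤
  where
  rowOK : ℕ → Bool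
  rowOK r = (entry c r ≤ᵇ 3) ∧ (2 ≤ᵇ windowSum k p c d r)

-- The state is the pair (previous, current) of columns.  The empty column [] has all
-- entries 0, so it adds no excess and stands for the missing columns beyond both ends of P_n.
State : Set
State = Column × Column

accepts : ℕ → State → List Column → Bool
accepts k (p , c) []       = windowOK k p c []
accepts k (p , c) (d ∷ ds) = windowOK k p c d ∧ accepts k (c , d) ds

passes : ℕ → State → List Column → Bool
passes k (p , c) []       = true
passes k (p , c) (d ∷ ds) = windowOK k p c d ∧ passes k (c , d) ds

after : State → List Column → State
after s       []       = s
after (p , c) (d ∷ ds) = after (c , d) ds

valid : ℕ → List Column → Bool
valid k []       = true
valid k (c ∷ cs) = accepts k ([] , c) cs

accepts-window : ∀ k p c ds j → T (accepts k (p , c) ds) → j ≤ length ds →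
                 T (windowOK k (column (p ∷ c ∷ ds) j) (column (c ∷ ds) j) (column ds j))
accepts-window k p c []       zero    ok _          = ok
accepts-window k p c (d ∷ ds) zero    ok _          = proj₁ (Equivalence.to T-∧ ok)
accepts-window k p c (d ∷ ds) (suc j) ok (s≤s j≤ds) =
  accepts-window k c d ds j (proj₂ (Equivalence.to T-∧ ok)) j≤ds

valid-window : ∀ k L j → T (valid k L) → j < length L →
               T (windowOK k (column ([] ∷ L) j) (column L j) (column L (suc j)))
valid-window k (c ∷ cs) j ok (s≤s j≤cs) = accepts-window k [] c cs j ok j≤cs

patternValue : (k : ℕ) .{{_ : NonZero k}} → List Column → ℕ → ℕ → ℕ
patternValue k L x y = entry (column L y) (x % k)

columnWeight : ℕ → Column → ℕ
columnWeight k c = ∑[ r < k ] entry c (toℕ r)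

patternWeight : ℕ → List Column → ℕ
patternWeight k L = sum (map (columnWeight k) L)

-- Patterns give double Roman dominating functions

module PatternDRDF (k t : ℕ) .{{_ : NonZero k}} (3≤m : 3 ≤ k * t)
                   (L : List Column) (valid-L : T (valid k L)) where

  m n : ℕ
  m = k * t
  n = length L

  G : Graph
  G = CylPath m n

  f : Vertex G → ℕ
  f = onGrid {m} {n} (patternValue k L)

  vertexWindowSum : Fin m → Fin n → ℕ
  vertexWindowSum i j = windowSum k (column ([] ∷ L) y) (column L y) (column L (suc y)) (toℕ i % k)
    where y = toℕ j

  vertex-window : ∀ i j → vertexWindowSum i j ≡ f (combine i j) + sum (map (λ u → f u ∸ 1) (cylNbrs i j))
  vertex-window i j =
    cong₂ _+_ (sym (onGrid-combine (patternValue k L) i j))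
      (cong₂ _+_ (cong (_∸ 1) (sym row-suc))
        (cong₂ _+_ (cong (_∸ 1) (sym row-pred)) vertical))
    where
    open ≡-Reasoning
    x = toℕ i
    y = toℕ j
    r = x % k
    c = column L y
    k∣m : k ∣ m
    k∣m = m∣m*n t
    row-suc : f (combine (rowSuc i) j) ≡ entry c (cycSuc k r)
    row-suc = begin
      f (combine (rowSuc i) j)          ≡⟨ onGrid-combine (patternValue k L) (rowSuc i) j ⟩
      entry c (toℕ (rowSuc i) % k)      ≡⟨ cong (λ x' → entry c (x' % k)) (toℕ-rowSuc i) ⟩
      entry c (cycSuc m x % k)          ≡⟨ cong (entry c) (cycSuc-% k∣m) ⟩
      entry c (cycSuc k r)              ∎
    row-pred : f (combine (rowPred i) j) ≡ entry c (cycPred k r)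
    row-pred = begin
      f (combine (rowPred i) j)         ≡⟨ onGrid-combine (patternValue k L) (rowPred i) j ⟩
      entry c (toℕ (rowPred i) % k)     ≡⟨ cong (λ x' → entry c (x' % k)) (toℕ-rowPred i) ⟩
      entry c (cycPred m x % k)         ≡⟨ cong (entry c) (cycPred-% k∣m (Finₚ.toℕ<n i)) ⟩
      entry c (cycPred k r)             ∎
    g : ℕ → ℕ
    g y' = entry (column ([] ∷ L) y') r ∸ 1
    vertical : (entry (column ([] ∷ L) y) r ∸ 1) + (entry (column L (suc y)) r ∸ 1) ≡
               sum (map (λ u → f u ∸ 1) (map (combine i) (pathNbrs j)))
    vertical = begin
      g y + g (2 + y)                                         ≡⟨ pathNbrs-sum g refl vanish j ⟩
      sum (map (g ∘ suc ∘ toℕ) (pathNbrs j))                  ≡⟨ cong sum (map-cong on-column (pathNbrs j)) ⟩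
      sum (map ((λ u → f u ∸ 1) ∘ combine i) (pathNbrs j))    ≡⟨ cong sum (map-∘ (pathNbrs j)) ⟩
      sum (map (λ u → f u ∸ 1) (map (combine i) (pathNbrs j))) ∎
      where
      vanish : ∀ y' → n ≤ y' → g (suc y') ≡ 0
      vanish y' n≤y' = cong (λ c' → entry c' r ∸ 1) (at-≥ [] L n≤y')
      on-column : ∀ j' → g (suc (toℕ j')) ≡ f (combine i j') ∸ 1
      on-column j' = cong (_∸ 1) (sym (onGrid-combine (patternValue k L) i j'))

  vertex-row : ∀ i j → entry (column L (toℕ j)) (toℕ i % k) ≤ 3 × 2 ≤ vertexWindowSum i j
  vertex-row i j = windowOK-row (column ([] ∷ L) y) (column L y) (column L (suc y))
    (valid-window k L y valid-L (Finₚ.toℕ<n j)) (m%n<n (toℕ i) k)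
    where y = toℕ j

  vertex-≤3 : ∀ i j → f (combine i j) ≤ 3
  vertex-≤3 i j = subst (_≤ 3) (sym (onGrid-combine (patternValue k L) i j)) (proj₁ (vertex-row i j))

  vertex-excess : ∀ i j → 2 ≤ f (combine i j) + excess G f (combine i j)
  vertex-excess i j = begin
    2                                                            ≤⟨ proj₂ (vertex-row i j) ⟩
    vertexWindowSum i j                                          ≡⟨ vertex-window i j ⟩
    f (combine i j) + sum (map (λ u → f u ∸ 1) (cylNbrs i j))
                                                                 ≤⟨ +-monoʳ-≤ _ (cylinder-excess 3≤m f i j) ⟩
    f (combine i j) + excess G f (combine i j)                   ∎
    where open ≤-Reasoning

  isDRDF : IsKRDF 2 G f
  isDRDF = ∀-combine vertex-≤3 , λ v _ → excess⇒roman-condition 2 G f v (∀-combine vertex-excess v)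

  column-periodic : ∀ c → ∑[ i < m ] entry c (toℕ i % k) ≡ t * columnWeight k c
  column-periodic c = begin
    ∑[ i < k * t ] entry c (toℕ i % k)   ≡⟨ cong (λ N → ∑[ i < N ] entry c (toℕ i % k)) (*-comm k t) ⟩
    ∑[ i < t * k ] entry c (toℕ i % k)   ≡⟨ ∑-periodic k t (λ x → entry c (x % k)) k-periodic ⟩
    t * ∑[ r < k ] entry c (toℕ r % k)
      ≡⟨ cong (t *_) (sum-cong-≗ {k} (cong (entry c) ∘ m<n⇒m%n≡m ∘ Finₚ.toℕ<n)) ⟩
    t * columnWeight k c                 ∎
    where
    open ≡-Reasoning
    k-periodic : ∀ x → entry c ((k + x) % k) ≡ entry c (x % k)
    k-periodic x = cong (entry c) (trans (cong (_% k) (+-comm k x)) ([m+n]%n≡m%n x k))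

  weight≡ : weight G f ≡ t * patternWeight k L
  weight≡ = begin
    weight G f
      ≡⟨ weight-onGrid {m} {n} (patternValue k L) ⟩
    ∑[ j < n ] ∑[ i < m ] patternValue k L (toℕ i) (toℕ j)
      ≡⟨ sum-cong-≗ {n} (column-periodic ∘ column L ∘ toℕ) ⟩
    ∑[ j < n ] (t * columnWeight k (column L (toℕ j)))
      ≡⟨ *-distribˡ-sum {n} t (columnWeight k ∘ column L ∘ toℕ) ⟨
    t * ∑[ j < n ] columnWeight k (column L (toℕ j))
      ≡⟨ cong (t *_) (∑-at [] (columnWeight k) L) ⟩
    t * patternWeight k L
      ∎
    where open ≡-Reasoning

pattern-DRDF : ∀ k t .{{_ : NonZero k}} → 3 ≤ k * t → (L : List Column) → T (valid k L) →
               let G = CylPath (k * t) (length L) in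
               Σ[ f ∈ (Vertex G → ℕ) ] IsKRDF 2 G f × weight G f ≡ t * patternWeight k L
pattern-DRDF k t 3≤m L valid-L = f , isDRDF , weight≡
  where open PatternDRDF k t 3≤m L valid-L

record Certifies (k : ℕ) (L : List Column) (n b : ℕ) : Set where
  constructor certificate
  field
    valid-L  : T (valid k L)
    length≡n : length L ≡ n
    weight≤b : patternWeight k L ≤ b

certifiesᵇ : ℕ → List Column → ℕ → ℕ → Bool
certifiesᵇ k L n b = valid k L ∧ (length L ≡ᵇ n) ∧ (patternWeight k L ≤ᵇ b)

certifiesᵇ⇒certifies : ∀ {k L n b} → T (certifiesᵇ k L n b) → Certifies k L n b
certifiesᵇ⇒certifies {k} {L} {n} {b} ok =
  let valid-L , rest = Equivalence.to T-∧ ok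
      length≡ , weight≤ = Equivalence.to T-∧ rest
  in certificate valid-L (≡ᵇ⇒≡ (length L) n length≡) (≤ᵇ⇒≤ (patternWeight k L) b weight≤)

pattern-bound : ∀ {k t n b γ} L → 3 ≤ k → 1 ≤ t → Certifies k L n b →
                IsDoubleRomanDomNumber (CylPath (k * t) n) γ → γ ≤ t * b
pattern-bound {k} {t} {b = b} {γ} L 3≤k 1≤t (certificate valid-L refl weight≤b) (_ , minimal) =
  let f , isDRDF , weight≡ = pattern-DRDF k t 3≤k*t L valid-L in begin
    γ                                        ≤⟨ minimal f isDRDF ⟩
    weight (CylPath (k * t) (length L)) f    ≡⟨ weight≡ ⟩
    t * patternWeight k L                    ≤⟨ *-monoʳ-≤ t weight≤b ⟩
    t * b                                    ∎
  where
  open ≤-Reasoning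
  instance
    k≢0 : NonZero k
    k≢0 = >-nonZero (≤-trans (s≤s z≤n) 3≤k)
    t≢0 : NonZero t
    t≢0 = >-nonZero 1≤t
  3≤k*t : 3 ≤ k * t
  3≤k*t = ≤-trans 3≤k (m≤m*n k t)

-- Periodic families of patterns

accepts-++ : ∀ k s xs ys → accepts k s (xs ++ ys) ≡ passes k s xs ∧ accepts k (after s xs) ys
accepts-++ k s       []       ys = refl
accepts-++ k (p , c) (d ∷ ds) ys =
  trans (cong (windowOK k p c d ∧_) (accepts-++ k (c , d) ds ys)) (sym (∧-assoc (windowOK k p c d) _ _))

accepts-pump : ∀ k {s} Q → after s Q ≡ s → T (passes k s Q) →
               ∀ q ys → accepts k s (concat (replicate q Q) ++ ys) ≡ accepts k s ys
accepts-pump k     Q loops passes-Q zero    ys = refl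
accepts-pump k {s} Q loops passes-Q (suc q) ys = begin
  accepts k s ((Q ++ Qᵠ) ++ ys)                    ≡⟨ cong (accepts k s) (++-assoc Q Qᵠ ys) ⟩
  accepts k s (Q ++ Qᵠ ++ ys)                      ≡⟨ accepts-++ k s Q (Qᵠ ++ ys) ⟩
  passes k s Q ∧ accepts k (after s Q) (Qᵠ ++ ys)  ≡⟨ cong₂ (λ b s' → b ∧ accepts k s' (Qᵠ ++ ys))
                                                           (Equivalence.to T-≡ passes-Q) loops ⟩
  accepts k s (Qᵠ ++ ys)                           ≡⟨ accepts-pump k Q loops passes-Q q ys ⟩
  accepts k s ys                                   ∎
  where
  open ≡-Reasoning
  Qᵠ = concat (replicate q Q)

stateAfter : List⁺ Column → State
stateAfter (c ∷ cs) = after ([] , c) cs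

valid-pump : ∀ k start Q → after (stateAfter start) Q ≡ stateAfter start → T (passes k (stateAfter start) Q) →
             ∀ q ys → valid k (toList start ++ concat (replicate q Q) ++ ys) ≡ valid k (toList start ++ ys)
valid-pump k (c ∷ cs) Q loops passes-Q q ys = begin
  accepts k ([] , c) (cs ++ Qᵠ ++ ys)                       ≡⟨ accepts-++ k ([] , c) cs _ ⟩
  passes k ([] , c) cs ∧ accepts k (after ([] , c) cs) (Qᵠ ++ ys)
    ≡⟨ cong (passes k ([] , c) cs ∧_) (accepts-pump k Q loops passes-Q q ys) ⟩
  passes k ([] , c) cs ∧ accepts k (after ([] , c) cs) ys   ≡⟨ accepts-++ k ([] , c) cs ys ⟨
  accepts k ([] , c) (cs ++ ys)                             ∎
  where
  open ≡-Reasoning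
  Qᵠ = concat (replicate q Q)

Additive : (List Column → ℕ) → Set
Additive μ = ∀ xs ys → μ (xs ++ ys) ≡ μ xs + μ ys

additive-repeat : ∀ μ → Additive μ → μ [] ≡ 0 → ∀ q Q → μ (concat (replicate q Q)) ≡ q * μ Q
additive-repeat μ μ-++ μ[]≡0 zero    Q = μ[]≡0
additive-repeat μ μ-++ μ[]≡0 (suc q) Q =
  trans (μ-++ Q _) (cong (μ Q +_) (additive-repeat μ μ-++ μ[]≡0 q Q))

additive-pump : ∀ μ → Additive μ → μ [] ≡ 0 →
                ∀ xs q Q ys → μ (xs ++ concat (replicate q Q) ++ ys) ≡ μ (xs ++ ys) + q * μ Q
additive-pump μ μ-++ μ[]≡0 xs q Q ys = begin
  μ (xs ++ Qᵠ ++ ys)       ≡⟨ trans (μ-++ xs _) (cong (μ xs +_) (μ-++ Qᵠ ys)) ⟩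
  μ xs + (μ Qᵠ + μ ys)     ≡⟨ cong (μ xs +_) (+-comm (μ Qᵠ) (μ ys)) ⟩
  μ xs + (μ ys + μ Qᵠ)     ≡⟨ +-assoc (μ xs) _ _ ⟨
  μ xs + μ ys + μ Qᵠ       ≡⟨ cong₂ _+_ (sym (μ-++ xs ys)) (additive-repeat μ μ-++ μ[]≡0 q Q) ⟩
  μ (xs ++ ys) + q * μ Q   ∎
  where
  open ≡-Reasoning
  Qᵠ = concat (replicate q Q)

length-additive : Additive length
length-additive xs ys = length-++ xs

patternWeight-additive : ∀ k → Additive (patternWeight k)
patternWeight-additive k xs ys =
  trans (cong sum (map-++ (columnWeight k) xs ys)) (sum-++ (map (columnWeight k) xs) _)

pumped : List⁺ Column → List Column → List Column → ℕ → ℕ → List Column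
pumped start period closing q r =
  toList start ++ concat (replicate q period) ++ take r period ++ column closing r ∷ []

-- For n = 4 + r + q·p with r < p = length period, the pattern for n consists of the prefix,
-- q copies of the period, its first r columns and column r of closing (see pumped).  As the
-- automaton is back in the same state after each period, validity is checked only for q = 0.
record PeriodicFamily (k : ℕ) (B : ℕ → ℕ) : Set where
  field
    prefix             : List⁺ Column
    period             : List Column
    closing            : List Column
    pattern₂ pattern₃  : List Column
    3≤k                : 3 ≤ k
    {{period≢[]}}      : NonZero (length period)
    period-loops       : after (stateAfter prefix) period ≡ stateAfter prefix
    period-passes      : T (passes k (stateAfter prefix) period)
    closings-certified : T (all (λ r → certifiesᵇ k (pumped prefix period closing 0 r) (4 + r) (B (4 + r)))
                                (upTo (length period)))
    pattern₂-certified : T (certifiesᵇ k pattern₂ 2 (B 2))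
    pattern₃-certified : T (certifiesᵇ k pattern₃ 3 (B 3))
    growth             : ∀ n → 2 ≤ n → B n + patternWeight k period ≤ B (n + length period)

  p : ℕ
  p = length period

  growth-iterated : ∀ q n → 2 ≤ n → B n + q * patternWeight k period ≤ B (n + q * p)
  growth-iterated zero    n _   = ≤-reflexive (trans (+-identityʳ (B n)) (cong B (sym (+-identityʳ n))))
  growth-iterated (suc q) n 2≤n = begin
    B n + (w + q * w)        ≡⟨ +-assoc (B n) w _ ⟨
    B n + w + q * w          ≤⟨ +-monoˡ-≤ _ (growth n 2≤n) ⟩
    B (n + p) + q * w        ≤⟨ growth-iterated q (n + p) (≤-trans 2≤n (m≤m+n n p)) ⟩
    B (n + p + q * p)        ≡⟨ cong B (+-assoc n p _) ⟩
    B (n + (p + q * p))      ∎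
    where
    open ≤-Reasoning
    w = patternWeight k period

  pumped-certifies : ∀ q r → r < p →
                     Certifies k (pumped prefix period closing q r) (4 + r + q * p) (B (4 + r + q * p))
  pumped-certifies q r r<p = certificate
    (subst T (sym (valid-pump k prefix period period-loops period-passes q Y)) valid₀)
    (trans (additive-pump length length-additive refl S q period Y) (cong (_+ q * p) length₀))
    (begin
      patternWeight k (S ++ Pᵠ ++ Y)
        ≡⟨ additive-pump (patternWeight k) (patternWeight-additive k) refl S q period Y ⟩
      patternWeight k (S ++ Y) + q * w           ≤⟨ +-monoˡ-≤ (q * w) weight₀ ⟩
      B (4 + r) + q * w                          ≤⟨ growth-iterated q (4 + r) (s≤s (s≤s z≤n)) ⟩
      B (4 + r + q * p)                          ∎)
    where
    open ≤-Reasoning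
    S = toList prefix
    Pᵠ = concat (replicate q period)
    Y = take r period ++ column closing r ∷ []
    w = patternWeight k period
    closing-r : Certifies k (S ++ Y) (4 + r) (B (4 + r))
    closing-r = certifiesᵇ⇒certifies (All.lookup (Allₚ.all⁺ _ (upTo p) closings-certified) (∈-upTo⁺ r<p))
    open Certifies closing-r renaming (valid-L to valid₀; length≡n to length₀; weight≤b to weight₀)

  patterns : ∀ n → 2 ≤ n → Σ[ L ∈ List Column ] Certifies k L n (B n)
  patterns 1 (s≤s ())
  patterns 2 _ = pattern₂ , certifiesᵇ⇒certifies pattern₂-certified
  patterns 3 _ = pattern₃ , certifiesᵇ⇒certifies pattern₃-certified
  patterns (suc (suc (suc (suc n)))) _ =
    subst (λ n → Σ[ L ∈ List Column ] Certifies k L n (B n)) (sym n≡)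
          (pumped prefix period closing (n / p) (n % p) , pumped-certifies (n / p) (n % p) (m%n<n n p))
    where
    n≡ : 4 + n ≡ 4 + n % p + n / p * p
    n≡ = trans (cong (4 +_) (m≡m%n+[m/n]*n n p)) (sym (+-assoc 4 (n % p) _))

  domination-bound : ∀ {t n γ} → 1 ≤ t → 2 ≤ n →
                     IsDoubleRomanDomNumber (CylPath (k * t) n) γ → γ ≤ t * B n
  domination-bound 1≤t 2≤n = pattern-bound (proj₁ (patterns _ 2≤n)) 3≤k 1≤t (proj₂ (patterns _ 2≤n))

digit : Char → ℕ
digit c = charCode c ∸ 48

digits : String → Column
digits = map digit ∘ chars

-- Each word is one column: the values on the k rows of C_k, in cyclic order.
columns : String → List Column
columns = map (map digit) ∘ wordsBy (T? ∘ isSpace) ∘ chars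

linear-growth : ∀ a c {w p} → w ≤ a * p → ∀ n → 2 ≤ n → a * n + c + w ≤ a * (n + p) + c
linear-growth a c {w} {p} w≤ap n _ = begin
  a * n + c + w        ≤⟨ +-monoʳ-≤ (a * n + c) w≤ap ⟩
  a * n + c + a * p    ≡⟨ regroup a c n p ⟩
  a * (n + p) + c      ∎
  where
  open ≤-Reasoning
  regroup : ∀ a c n p → a * n + c + a * p ≡ a * (n + p) + c
  regroup = solve-∀

-- B₆ and B₇ merge the residue classes of the theorem into one formula each.
offset₆ : ℕ → ℕ
offset₆ 0 = 3
offset₆ 1 = 0
offset₆ _ = 2

B₆ : ℕ → ℕ
B₆ n = 3 * ((4 * n + 2) / 3) + offset₆ (n % 3)

B₇ : ℕ → ℕ
B₇ n = (9 * n + 10 + n % 2) / 2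

B₈ : ℕ → ℕ
B₈ n = 6 * n ∸ ((n ∸ 2) / 5 + n / 5) + 4

[m+kn]/n≡m/n+k : ∀ m k n .{{_ : NonZero n}} → (m + k * n) / n ≡ m / n + k
[m+kn]/n≡m/n+k m k n = trans (+-distrib-/-∣ʳ m (divides-refl k)) (cong (m / n +_) (m*n/n≡m k n))

[m+n]∸[o+p]≡[m∸o]+[n∸p] : ∀ {m n o p} → o ≤ m → p ≤ n → (m + n) ∸ (o + p) ≡ (m ∸ o) + (n ∸ p)
[m+n]∸[o+p]≡[m∸o]+[n∸p] {m} {n} {o} {p} o≤m p≤n = begin
  (m + n) ∸ (o + p)    ≡⟨ ∸-+-assoc (m + n) o p ⟨
  (m + n) ∸ o ∸ p      ≡⟨ cong (_∸ p) (+-∸-comm n o≤m) ⟩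
  (m ∸ o + n) ∸ p      ≡⟨ +-∸-assoc (m ∸ o) p≤n ⟩
  (m ∸ o) + (n ∸ p)    ∎
  where open ≡-Reasoning

B₆-growth : ∀ n → 2 ≤ n → B₆ n + 24 ≤ B₆ (n + 6)
B₆-growth n _ = ≤-reflexive (begin
  3 * x + offset₆ (n % 3) + 24
    ≡⟨ regroup x (offset₆ (n % 3)) ⟩
  3 * (x + 8) + offset₆ (n % 3)
    ≡⟨ cong₂ (λ y r → 3 * y + offset₆ r) ([m+kn]/n≡m/n+k (4 * n + 2) 8 3) ([m+kn]%n≡m%n n 2 3) ⟨
  3 * ((4 * n + 2 + 8 * 3) / 3) + offset₆ ((n + 6) % 3)
    ≡⟨ cong (λ y → 3 * (y / 3) + offset₆ ((n + 6) % 3)) (expand n) ⟩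
  3 * ((4 * (n + 6) + 2) / 3) + offset₆ ((n + 6) % 3)
    ∎)
  where
  open ≡-Reasoning
  x = (4 * n + 2) / 3
  regroup : ∀ x e → 3 * x + e + 24 ≡ 3 * (x + 8) + e
  regroup = solve-∀
  expand : ∀ n → 4 * n + 2 + 8 * 3 ≡ 4 * (n + 6) + 2
  expand = solve-∀

B₇-growth : ∀ n → 2 ≤ n → B₇ n + 63 ≤ B₇ (n + 14)
B₇-growth n _ = ≤-reflexive (begin
  (9 * n + 10 + n % 2) / 2 + 63                   ≡⟨ [m+kn]/n≡m/n+k (9 * n + 10 + n % 2) 63 2 ⟨
  (9 * n + 10 + n % 2 + 63 * 2) / 2               ≡⟨ cong (_/ 2) (expand n (n % 2)) ⟩
  (9 * (n + 14) + 10 + n % 2) / 2                 ≡⟨ cong (λ r → (9 * (n + 14) + 10 + r) / 2) ([m+kn]%n≡m%n n 7 2) ⟨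
  (9 * (n + 14) + 10 + (n + 14) % 2) / 2          ∎)
  where
  open ≡-Reasoning
  expand : ∀ n r → 9 * n + 10 + r + 63 * 2 ≡ 9 * (n + 14) + 10 + r
  expand = solve-∀

B₈-growth : ∀ n → 2 ≤ n → B₈ n + 54 ≤ B₈ (n + 10)
B₈-growth n 2≤n = begin
  6 * n ∸ F + 4 + 54                          ≤⟨ +-monoʳ-≤ (6 * n ∸ F + 4) (≤ᵇ⇒≤ 54 56 _) ⟩
  6 * n ∸ F + 4 + 56                          ≡⟨ +-comm (6 * n ∸ F + 4) 56 ⟩
  56 + (6 * n ∸ F + 4)                        ≡⟨ +-assoc 56 (6 * n ∸ F) 4 ⟨
  56 + (6 * n ∸ F) + 4                        ≡⟨ cong (_+ 4) (+-comm 56 (6 * n ∸ F)) ⟩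
  (6 * n ∸ F) + (60 ∸ 4) + 4                  ≡⟨ cong (_+ 4) ([m+n]∸[o+p]≡[m∸o]+[n∸p] F≤6n (≤ᵇ⇒≤ 4 60 _)) ⟨
  (6 * n + 60) ∸ (F + 4) + 4                  ≡⟨ cong₂ (λ a b → a ∸ b + 4) (*-distribˡ-+ 6 n 10) F+4≡ ⟨
  6 * (n + 10) ∸ (((n + 10) ∸ 2) / 5 + (n + 10) / 5) + 4 ∎
  where
  open ≤-Reasoning
  F = (n ∸ 2) / 5 + n / 5
  F≤6n : F ≤ 6 * n
  F≤6n = ≤-trans (+-mono-≤ (≤-trans (m/n≤m (n ∸ 2) 5) (m∸n≤m n 2)) (m/n≤m n 5))
                 (+-monoʳ-≤ n (m≤n*m n 5))
  F+4≡ : ((n + 10) ∸ 2) / 5 + (n + 10) / 5 ≡ F + 4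
  F+4≡ = begin-equality
    ((n + 10) ∸ 2) / 5 + (n + 10) / 5         ≡⟨ cong (λ y → y / 5 + (n + 10) / 5) (+-∸-comm 10 2≤n) ⟩
    ((n ∸ 2) + 2 * 5) / 5 + (n + 2 * 5) / 5   ≡⟨ cong₂ _+_ ([m+kn]/n≡m/n+k (n ∸ 2) 2 5) ([m+kn]/n≡m/n+k n 2 5) ⟩
    ((n ∸ 2) / 5 + 2) + (n / 5 + 2)           ≡⟨ regroup ((n ∸ 2) / 5) (n / 5) ⟩
    F + 4                                     ∎
    where
    regroup : ∀ a b → a + 2 + (b + 2) ≡ a + b + 4
    regroup = solve-∀

family₃ : PeriodicFamily 3 (λ n → 2 * n + 2)
family₃ = record
  { prefix             = digits "300" ∷ columns "020 002"
  ; period             = columns "200 020 002"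
  ; closing            = columns "300 030 003"
  ; pattern₂           = columns "300 030"
  ; pattern₃           = columns "300 020 003"
  ; 3≤k                = m≤m+n 3 _
  ; period-loops       = refl
  ; period-passes      = _
  ; closings-certified = _
  ; pattern₂-certified = _
  ; pattern₃-certified = _
  ; growth             = linear-growth 2 2 ≤-refl
  }

family₄ : PeriodicFamily 4 (λ n → 3 * n)
family₄ = record
  { prefix             = digits "3000" ∷ columns "0030 3000"
  ; period             = columns "0030 3000"
  ; closing            = columns "0030 3000"
  ; pattern₂           = columns "3000 0030"
  ; pattern₃           = columns "3000 0030 3000"
  ; 3≤k                = m≤m+n 3 _
  ; period-loops       = refl
  ; period-passes      = _
  ; closings-certified = _
  ; pattern₂-certified = _
  ; pattern₃-certified = _
  ; growth             = λ n _ → ≤-reflexive (sym (*-distribˡ-+ 3 n 2))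
  }

family₅ : PeriodicFamily 5 (λ n → 3 * n + 4)
family₅ = record
  { prefix             = digits "30020" ∷ columns "00300 00003"
  ; period             = columns "03000 00030 30000 00300 00003"
  ; closing            = columns "03020 20030 30200 00302 02003"
  ; pattern₂           = columns "30020 00302"
  ; pattern₃           = columns "30020 00300 02003"
  ; 3≤k                = m≤m+n 3 _
  ; period-loops       = refl
  ; period-passes      = _
  ; closings-certified = _
  ; pattern₂-certified = _
  ; pattern₃-certified = _
  ; growth             = linear-growth 3 4 ≤-refl
  }

family₆ : PeriodicFamily 6 B₆
family₆ = record
  { prefix             = digits "300030" ∷ columns "003000 000003"
  ; period             = columns "030300 000003 003000 300030 003000 000003"
  ; closing            = columns "030300 002003 003003 300030 003002 003003"
  ; pattern₂           = columns "300030 003002"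
  ; pattern₃           = columns "300030 003000 003003"
  ; 3≤k                = m≤m+n 3 _
  ; period-loops       = refl
  ; period-passes      = _
  ; closings-certified = _
  ; pattern₂-certified = _
  ; pattern₃-certified = _
  ; growth             = B₆-growth
  }

family₇ : PeriodicFamily 7 B₇
family₇ = record
  { prefix             = digits "0003003" ∷ columns "0300003 0000300"
  ; period             = columns "3030000 0000030 0303000 0000003 0030300 3000000 0003030 0300000 0000303 0030000 3000030 0003000 0300003 0000300"
  ; closing            = columns "3030020 0030030 0303002 0003003 2030300 3000300 0203030 0300030 0020303 0030003 3002030 3003000 0300203 0300300"
  ; pattern₂           = columns "0003003 0300203"
  ; pattern₃           = columns "0003003 0300003 0300300"
  ; 3≤k                = m≤m+n 3 _
  ; period-loops       = refl
  ; period-passes      = _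
  ; closings-certified = _
  ; pattern₂-certified = _
  ; pattern₃-certified = _
  ; growth             = B₇-growth
  }

family₈ : PeriodicFamily 8 B₈
family₈ = record
  { prefix             = digits "30020030" ∷ columns "00303000 00000003"
  ; period             = columns "03030300 00000003 00303000 30000030 00030000 03000303 00030000 30000030 00303000 00000003"
  ; closing            = columns "03030300 00030003 00303003 30020030 02030030 03000303 00030003 30030030 00303002 00300203"
  ; pattern₂           = columns "30020030 00303002"
  ; pattern₃           = columns "30020030 00303000 00300203"
  ; 3≤k                = m≤m+n 3 _
  ; period-loops       = refl
  ; period-passes      = _
  ; closings-certified = _
  ; pattern₂-certified = _
  ; pattern₃-certified = _
  ; growth             = B₈-growth
  }

family₉ : PeriodicFamily 9 (λ n → 6 * n + 4)
family₉ = record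
  { prefix             = digits "300030200" ∷ columns "003000030 300003000"
  ; period             = columns "000300003 030000300 000030003 003000030 300003000"
  ; closing            = columns "020300030 030020300 002030003 203000300 300203000"
  ; pattern₂           = columns "000300203 030003020"
  ; pattern₃           = columns "300030200 003000030 300203000"
  ; 3≤k                = m≤m+n 3 _
  ; period-loops       = refl
  ; period-passes      = _
  ; closings-certified = _
  ; pattern₂-certified = _
  ; pattern₃-certified = _
  ; growth             = linear-growth 6 4 ≤-refl
  }

corollary1 : ∀ (t n : ℕ) → 1 ≤ t → 2 ≤ n → ∀ (m γ : ℕ) →
    IsDoubleRomanDomNumber (CylPath m n) γ →
    (m ≡ 3 * t → γ ≤ t * (2 * n + 2)) ×
    (m ≡ 4 * t → γ ≤ 3 * t * n) ×
    (m ≡ 5 * t → γ ≤ t * (3 * n + 4)) ×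
    (m ≡ 6 * t → n % 3 ≡ 0 → γ ≤ t * (3 * ((4 * n + 2) / 3) + 3)) ×
    (m ≡ 6 * t → n % 3 ≡ 1 → γ ≤ 3 * t * ((4 * n + 2) / 3)) ×
    (m ≡ 6 * t → n % 3 ≡ 2 → γ ≤ t * (3 * ((4 * n + 2) / 3) + 2)) ×
    (m ≡ 7 * t → n % 2 ≡ 1 → γ ≤ t * ((9 * n + 11) / 2)) ×
    (m ≡ 7 * t → n % 2 ≡ 0 → γ ≤ t * ((9 * n + 10) / 2)) ×
    (m ≡ 8 * t → γ ≤ t * (6 * n ∸ ((n ∸ 2) / 5 + n / 5) + 4)) ×
    (m ≡ 9 * t → γ ≤ t * (6 * n + 4))
corollary1 t n 1≤t 2≤n m γ γ-minimum =
    bound family₃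
  , (λ m≡4t → subst (γ ≤_) (t*[3*x]≡3*t*x n) (bound family₄ m≡4t))
  , bound family₅
  , bound₆
  , (λ m≡6t n%3≡1 → subst (γ ≤_) (trans (cong (t *_) (+-identityʳ _)) (t*[3*x]≡3*t*x _))
                                 (bound₆ m≡6t n%3≡1))
  , bound₆
  , (λ m≡7t n%2≡1 → subst (λ x → γ ≤ t * (x / 2)) (+-assoc (9 * n) 10 1) (bound₇ m≡7t n%2≡1))
  , (λ m≡7t n%2≡0 → subst (λ x → γ ≤ t * (x / 2)) (+-identityʳ (9 * n + 10)) (bound₇ m≡7t n%2≡0))
  , bound family₈
  , bound family₉
  where
  bound : ∀ {k B} → PeriodicFamily k B → m ≡ k * t → γ ≤ t * B n
  bound F m≡kt = PeriodicFamily.domination-bound F 1≤t 2≤n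
    (subst (λ m → IsDoubleRomanDomNumber (CylPath m n) γ) m≡kt γ-minimum)
  bound₆ : ∀ {r} → m ≡ 6 * t → n % 3 ≡ r → γ ≤ t * (3 * ((4 * n + 2) / 3) + offset₆ r)
  bound₆ m≡6t refl = bound family₆ m≡6t
  bound₇ : ∀ {r} → m ≡ 7 * t → n % 2 ≡ r → γ ≤ t * ((9 * n + 10 + r) / 2)
  bound₇ m≡7t refl = bound family₇ m≡7t
  t*[3*x]≡3*t*x : ∀ x → t * (3 * x) ≡ 3 * t * x
  t*[3*x]≡3*t*x x = trans (sym (*-assoc t 3 x)) (cong (_* x) (*-comm t 3))
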